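{- Let $n\ge 3$ and $k=\lfloor n/2\rfloor$. Let $DC_n^{(i,n-i)}$ be the digraph on vertex set $\{1,2,\ldots,n\}$ whose arcs are the arcs $(t,t+1)$ for $1\le t\le n-1$, the arc $(n,1)$, and the arcs $(i,n-i)$ for $i\in\{1,2,\ldots,k-1\}$. Then the characteristic polynomial of $DC_n^{(i,n-i)}$ is $$\Psi_{DC_n^{(i,n-i)}}(x)=x^n-\sum_{t=1}^{k-1}x^{n-(2t+1)}-1 .$$
   Context: The characteristic polynomial $\Psi_X(x)$ of a digraph $X$ is $\det(xI-A)$, where $A$ is the adjacency matrix of $X$ (the $(i,j)$ entry is the number of arcs from $i$ to $j$). -}

module Defs where

open import Data.Nat as ℕ using (ℕ; zero; suc; _∸_; _≡ᵇ_)
open import Data.Nat.DivMod using (_/_)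
open import Data.Integer as ℤ using (ℤ; +_; -_)
open import Data.Fin as Fin using (Fin; toℕ; punchIn)
open import Data.List using (List; []; _∷_; map; _++_; replicate; foldr; upTo)
open import Data.Product using (_×_; _,_)
open import Data.Bool using (Bool; true; false; if_then_else_; _∧_)
open import Relation.Nullary using (does)
open import Relation.Binary.PropositionalEquality using (_≡_)

-- Polynomials over ℤ as coefficient lists (constant term first).
-- Equality of polynomials is coefficientwise (trailing zeros irrelevant).

Poly : Set
Poly = List ℤ

coeff : Poly → ℕ → ℤ
coeff []       _       = + 0
coeff (a ∷ p)  zero    = a
coeff (a ∷ p)  (suc i) = coeff p i

infix 4 _≈P_
_≈P_ : Poly → Poly → Set
p ≈P q = ∀ i → coeff p i ≡ coeff q i

infixl 6 _+P_ _-P_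
infixl 7 _*P_

_+P_ : Poly → Poly → Poly
[]      +P q       = q
(a ∷ p) +P []      = a ∷ p
(a ∷ p) +P (b ∷ q) = (a ℤ.+ b) ∷ (p +P q)

_·P_ : ℤ → Poly → Poly
a ·P p = map (a ℤ.*_) p

negP : Poly → Poly
negP p = map -_ p

_-P_ : Poly → Poly → Poly
p -P q = p +P negP q

_*P_ : Poly → Poly → Poly
[]      *P q = []
(a ∷ p) *P q = (a ·P q) +P (+ 0 ∷ (p *P q))

constP : ℤ → Poly
constP a = a ∷ []

X^ : ℕ → Poly
X^ m = replicate m (+ 0) ++ (+ 1 ∷ [])

X : Poly
X = X^ 1

sumP : List Poly → Poly
sumP = foldr _+P_ []

sumFin : ∀ {n} → (Fin n → Poly) → Poly
sumFin {zero}  f = []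
sumFin {suc n} f = f Fin.zero +P sumFin (λ j → f (Fin.suc j))

sign : ℕ → ℤ
sign zero    = + 1
sign (suc n) = - sign n

det : ∀ n → (Fin n → Fin n → Poly) → Poly
det zero    M = constP (+ 1)
det (suc n) M =
  sumFin (λ j → sign (toℕ j) ·P (M Fin.zero j *P det n (λ r c → M (Fin.suc r) (punchIn j c))))

-- Digraphs on vertex set {1,…,n}, given by a list of arcs (multiplicity
-- allowed).  Vertex v : Fin n stands for the number toℕ v + 1.

Arcs : Set
Arcs = List (ℕ × ℕ)

countArcs : Arcs → ℕ → ℕ → ℕ
countArcs []             a b = 0
countArcs ((s , t) ∷ as) a b =
  (if (s ≡ᵇ a) ∧ (t ≡ᵇ b) then 1 else 0) ℕ.+ countArcs as a b

adjacency : ∀ n → Arcs → Fin n → Fin n → ℕ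
adjacency n as i j = countArcs as (suc (toℕ i)) (suc (toℕ j))

charPoly : ∀ n → (Fin n → Fin n → ℕ) → Poly
charPoly n A = det n (λ i j → (if does (i Fin.≟ j) then X else []) -P constP (+ (A i j)))

oneTo : ℕ → List ℕ
oneTo m = map suc (upTo m)

DC : ℕ → Arcs
DC n = map (λ t → (t , suc t)) (oneTo (n ∸ 1))
    ++ ((n , 1) ∷ [])
    ++ map (λ i → (i , n ∸ i)) (oneTo ((n / 2) ∸ 1))

-- Write n = m + 3 and M = x I - A.  Column 0 of M holds only x
-- (row 0) and -1 (the closing arc n → 1, last row), so expanding along it
--   det M = x · det M₀ + (-1)^(n-1) · (-1) · det S,
-- where M₀ (delete row 0, column 0) is upper triangular with x on the
-- diagonal, so det M₀ = x^(n-1), and S (delete the last row and column 0)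
-- is a chord matrix: -1 on the diagonal (the path arcs), x on the
-- subdiagonal, and -1 at the chord positions (r , m - r), r < k - 1.
-- Expanding a chord matrix along row 0, which has two nonzero entries,
-- produces a chord matrix with one chord less and a block triangular
-- matrix; by induction det S = (-1)^(n-1) (x^(n-3) + x^(n-5) + … + 1).
module Submission where

open import Defs
open import Data.Nat as ℕ using (ℕ; zero; suc; _≤_; _<_; z≤n; s≤s; _∸_; _+_; _*_; _≡ᵇ_)
open import Data.Nat.Properties as ℕP using ()
open import Data.Nat.DivMod using (_/_; m/n*n≤m)
open import Data.Integer as ℤ using (ℤ; +_; -_; -1ℤ)
open import Data.Integer.Properties as ℤP using ()
open import Data.Integer.Tactic.RingSolver using (solve-∀)
import Data.Nat.Tactic.RingSolver as ℕSolver
open import Data.Fin as Fin using (Fin; toℕ; punchIn; punchOut; inject₁; fromℕ)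
open import Data.Fin.Properties as FinP using ()
open import Data.List using ([]; _∷_; map; _++_; upTo; applyUpTo)
open import Data.List.Properties as LP using ()
open import Data.Bool using (true; false; if_then_else_; _∧_; T)
open import Data.Unit using (tt)
open import Data.Product using (_,_)
open import Data.Sum using (inj₁; inj₂)
open import Data.Empty using (⊥; ⊥-elim)
open import Function using (_∘_)
open import Level using (0ℓ)
open import Relation.Binary.Bundles using (Setoid)
open import Relation.Binary.PropositionalEquality hiding (J)
open import Relation.Nullary using (yes; no; does)
open import Relation.Nullary.Decidable using (dec-true; dec-false)
import Relation.Binary.Reasoning.Setoid as SetoidReasoning

-- The record type
-- former is injective, so Agda can infer the two polynomials from a proof
-- of p ≋ q; this lets the lemmas below take their polynomials implicitly.

infix 4 _≋_
record _≋_ (p q : Poly) : Set where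
  constructor coeffwise
  field coeff-≡ : ∀ i → coeff p i ≡ coeff q i
open _≋_

≋-refl : ∀ {p} → p ≋ p
≋-refl = coeffwise λ i → refl

≋-sym : ∀ {p q} → p ≋ q → q ≋ p
≋-sym e = coeffwise λ i → sym (coeff-≡ e i)

≋-trans : ∀ {p q r} → p ≋ q → q ≋ r → p ≋ r
≋-trans e f = coeffwise λ i → trans (coeff-≡ e i) (coeff-≡ f i)

≋-reflexive : ∀ {p q} → p ≡ q → p ≋ q
≋-reflexive refl = ≋-refl

≋-setoid : Setoid 0ℓ 0ℓ
≋-setoid = record
  { Carrier = Poly
  ; _≈_ = _≋_
  ; isEquivalence = record { refl = ≋-refl ; sym = ≋-sym ; trans = ≋-trans }
  }

module ≋-Reasoning = SetoidReasoning ≋-setoid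

coeff-+P : ∀ p q i → coeff (p +P q) i ≡ coeff p i ℤ.+ coeff q i
coeff-+P []      q       i       = sym (ℤP.+-identityˡ _)
coeff-+P (a ∷ p) []      i       = sym (ℤP.+-identityʳ _)
coeff-+P (a ∷ p) (b ∷ q) zero    = refl
coeff-+P (a ∷ p) (b ∷ q) (suc i) = coeff-+P p q i

coeff-·P : ∀ a p i → coeff (a ·P p) i ≡ a ℤ.* coeff p i
coeff-·P a []      i       = sym (ℤP.*-zeroʳ a)
coeff-·P a (b ∷ p) zero    = refl
coeff-·P a (b ∷ p) (suc i) = coeff-·P a p i

coeff-negP : ∀ p i → coeff (negP p) i ≡ - coeff p i
coeff-negP []      i       = refl
coeff-negP (a ∷ p) zero    = refl
coeff-negP (a ∷ p) (suc i) = coeff-negP p i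

shift-cong : ∀ {p q} → p ≋ q → (+ 0 ∷ p) ≋ (+ 0 ∷ q)
shift-cong e = coeffwise λ { zero → refl ; (suc i) → coeff-≡ e i }

coeff-*P-∷ : ∀ a p q i → coeff ((a ∷ p) *P q) i ≡ a ℤ.* coeff q i ℤ.+ coeff (+ 0 ∷ (p *P q)) i
coeff-*P-∷ a p q i = trans (coeff-+P (a ·P q) _ i) (cong (ℤ._+ _) (coeff-·P a q i))

+P-cong : ∀ {p p′ q q′} → p ≋ p′ → q ≋ q′ → p +P q ≋ p′ +P q′
+P-cong {p} {p′} {q} {q′} e f = coeffwise λ i →
  trans (coeff-+P p q i) (trans (cong₂ ℤ._+_ (coeff-≡ e i) (coeff-≡ f i)) (sym (coeff-+P p′ q′ i)))

negP-cong : ∀ {p q} → p ≋ q → negP p ≋ negP q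
negP-cong {p} {q} e = coeffwise λ i →
  trans (coeff-negP p i) (trans (cong -_ (coeff-≡ e i)) (sym (coeff-negP q i)))

-P-cong : ∀ {p p′ q q′} → p ≋ p′ → q ≋ q′ → p -P q ≋ p′ -P q′
-P-cong e f = +P-cong e (negP-cong f)

·P-cong : ∀ a {p q} → p ≋ q → a ·P p ≋ a ·P q
·P-cong a {p} {q} e = coeffwise λ i →
  trans (coeff-·P a p i) (trans (cong (a ℤ.*_) (coeff-≡ e i)) (sym (coeff-·P a q i)))

*P-congʳ : ∀ p {q q′} → q ≋ q′ → p *P q ≋ p *P q′
*P-congʳ []      e = ≋-refl
*P-congʳ (a ∷ p) {q} {q′} e = coeffwise λ i →
  trans (coeff-*P-∷ a p q i)
    (trans (cong₂ (λ u v → a ℤ.* u ℤ.+ v) (coeff-≡ e i) (coeff-≡ (shift-cong (*P-congʳ p e)) i))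
      (sym (coeff-*P-∷ a p q′ i)))

*P-zeroˡ : ∀ {p} q → p ≋ [] → p *P q ≋ []
*P-zeroˡ {[]}    q e = ≋-refl
*P-zeroˡ {a ∷ p} q e = coeffwise λ i →
  trans (coeff-*P-∷ a p q i)
    (trans (cong₂ (λ u v → u ℤ.* coeff q i ℤ.+ v) (coeff-≡ e zero) (coeff-≡ (shift-cong tail-vanishes) i))
      (vanish i))
  where
  tail-vanishes : p *P q ≋ []
  tail-vanishes = *P-zeroˡ {p} q (coeffwise λ j → coeff-≡ e (suc j))
  vanish : ∀ i → + 0 ℤ.* coeff q i ℤ.+ coeff (+ 0 ∷ []) i ≡ + 0
  vanish zero    = refl
  vanish (suc i) = refl

*P-congˡ : ∀ {p p′} q → p ≋ p′ → p *P q ≋ p′ *P q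
*P-congˡ {[]}    {[]}     q e = ≋-refl
*P-congˡ {[]}    {a ∷ p′} q e = ≋-sym (*P-zeroˡ q (≋-sym e))
*P-congˡ {a ∷ p} {[]}     q e = *P-zeroˡ q e
*P-congˡ {a ∷ p} {a′ ∷ p′} q e = coeffwise λ i →
  trans (coeff-*P-∷ a p q i)
    (trans (cong₂ (λ u v → u ℤ.* coeff q i ℤ.+ v) (coeff-≡ e zero) (coeff-≡ (shift-cong tails) i))
      (sym (coeff-*P-∷ a′ p′ q i)))
  where
  tails : p *P q ≋ p′ *P q
  tails = *P-congˡ {p} {p′} q (coeffwise λ j → coeff-≡ e (suc j))

*P-cong : ∀ {p p′ q q′} → p ≋ p′ → q ≋ q′ → p *P q ≋ p′ *P q′
*P-cong {p′ = p′} {q} e f = ≋-trans (*P-congˡ q e) (*P-congʳ p′ f)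

*P-zeroʳ : ∀ p {q} → q ≋ [] → p *P q ≋ []
*P-zeroʳ p e = ≋-trans (*P-congʳ p e) (times-[] p)
  where
  times-[] : ∀ p → p *P [] ≋ []
  times-[] []      = ≋-refl
  times-[] (a ∷ p) = coeffwise λ { zero → refl ; (suc i) → coeff-≡ (times-[] p) i }

·P-identity : ∀ p → (+ 1) ·P p ≋ p
·P-identity p = coeffwise λ i → trans (coeff-·P (+ 1) p i) (ℤP.*-identityˡ _)

·P-assoc : ∀ a b p → a ·P (b ·P p) ≋ (a ℤ.* b) ·P p
·P-assoc a b p = coeffwise λ i →
  trans (coeff-·P a (b ·P p) i)
    (trans (cong (a ℤ.*_) (coeff-·P b p i)) (trans (sym (ℤP.*-assoc a b _)) (sym (coeff-·P (a ℤ.* b) p i))))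

*P-·P : ∀ p a q → p *P (a ·P q) ≋ a ·P (p *P q)
*P-·P []      a q = ≋-refl
*P-·P (b ∷ p) a q = coeffwise λ i → begin
  coeff ((b ∷ p) *P (a ·P q)) i                                 ≡⟨ coeff-*P-∷ b p (a ·P q) i ⟩
  b ℤ.* coeff (a ·P q) i ℤ.+ coeff (+ 0 ∷ (p *P (a ·P q))) i    ≡⟨ cong (λ v → b ℤ.* coeff (a ·P q) i ℤ.+ v) (coeff-≡ (shift-cong (*P-·P p a q)) i) ⟩
  b ℤ.* coeff (a ·P q) i ℤ.+ coeff (+ 0 ∷ (a ·P (p *P q))) i    ≡⟨ pull-scalar i ⟩
  a ℤ.* (b ℤ.* coeff q i ℤ.+ coeff (+ 0 ∷ (p *P q)) i)          ≡⟨ cong (a ℤ.*_) (coeff-*P-∷ b p q i) ⟨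
  a ℤ.* coeff ((b ∷ p) *P q) i                                  ≡⟨ coeff-·P a ((b ∷ p) *P q) i ⟨
  coeff (a ·P ((b ∷ p) *P q)) i                                 ∎
  where
  open ≡-Reasoning
  pull-scalar : ∀ i → b ℤ.* coeff (a ·P q) i ℤ.+ coeff (+ 0 ∷ (a ·P (p *P q))) i
                    ≡ a ℤ.* (b ℤ.* coeff q i ℤ.+ coeff (+ 0 ∷ (p *P q)) i)
  pull-scalar zero    = trans (cong (λ u → b ℤ.* u ℤ.+ + 0) (coeff-·P a q zero)) (identity b a (coeff q zero))
    where
    identity : ∀ b a c → b ℤ.* (a ℤ.* c) ℤ.+ + 0 ≡ a ℤ.* (b ℤ.* c ℤ.+ + 0)
    identity = solve-∀
  pull-scalar (suc i) =
    trans (cong₂ (λ u v → b ℤ.* u ℤ.+ v) (coeff-·P a q (suc i)) (coeff-·P a (p *P q) i)) (identity b a _ _)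
    where
    identity : ∀ b a c d → b ℤ.* (a ℤ.* c) ℤ.+ a ℤ.* d ≡ a ℤ.* (b ℤ.* c ℤ.+ d)
    identity = solve-∀

constP-*P : ∀ a q → constP a *P q ≋ a ·P q
constP-*P a q = coeffwise λ i →
  trans (coeff-*P-∷ a [] q i)
    (trans (cong₂ ℤ._+_ (sym (coeff-·P a q i)) (coeff-empty-shift i)) (ℤP.+-identityʳ _))
  where
  coeff-empty-shift : ∀ i → coeff (+ 0 ∷ []) i ≡ + 0
  coeff-empty-shift zero    = refl
  coeff-empty-shift (suc i) = refl

X-*P : ∀ q → X *P q ≋ (+ 0 ∷ q)
X-*P q = ≋-trans (coeffwise λ i → trans (coeff-*P-∷ (+ 0) (+ 1 ∷ []) q i) (ℤP.+-identityˡ _))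
                 (shift-cong (≋-trans (constP-*P (+ 1) q) (·P-identity q)))

+P-identityʳ : ∀ p {q} → q ≋ [] → p +P q ≋ p
+P-identityʳ p {q} e = coeffwise λ i →
  trans (coeff-+P p q i) (trans (cong (λ v → coeff p i ℤ.+ v) (coeff-≡ e i)) (ℤP.+-identityʳ _))

sign-+ : ∀ a b → sign (a + b) ≡ sign a ℤ.* sign b
sign-+ zero    b = sym (ℤP.*-identityˡ _)
sign-+ (suc a) b = trans (cong -_ (sign-+ a b)) (ℤP.neg-distribˡ-* (sign a) (sign b))

sign-square : ∀ a → sign a ℤ.* sign a ≡ + 1
sign-square zero    = refl
sign-square (suc a) = trans (negations-cancel (sign a)) (sign-square a)
  where
  negations-cancel : ∀ x → (- x) ℤ.* (- x) ≡ x ℤ.* x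
  negations-cancel = solve-∀

minusOne-*P-sign : ∀ p q → constP -1ℤ *P (sign p ·P q) ≋ sign (suc p) ·P q
minusOne-*P-sign p q = begin
  constP -1ℤ *P (sign p ·P q)  ≈⟨ constP-*P -1ℤ (sign p ·P q) ⟩
  -1ℤ ·P (sign p ·P q)         ≈⟨ ·P-assoc -1ℤ (sign p) q ⟩
  (-1ℤ ℤ.* sign p) ·P q        ≡⟨ cong (_·P q) (ℤP.-1*i≡-i (sign p)) ⟩
  sign (suc p) ·P q            ∎
  where open ≋-Reasoning

Mat : ℕ → Set
Mat n = Fin n → Fin n → Poly

minor : ∀ {n} → Fin (suc n) → Mat (suc n) → Mat n
minor j M r c = M (Fin.suc r) (punchIn j c)

cofactor : ∀ {n} → Mat (suc n) → Fin (suc n) → Poly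
cofactor {n} M j = sign (toℕ j) ·P (M Fin.zero j *P det n (minor j M))

sumFin-cong : ∀ {n} {f g : Fin n → Poly} → (∀ j → f j ≋ g j) → sumFin f ≋ sumFin g
sumFin-cong {zero}  e = ≋-refl
sumFin-cong {suc n} e = +P-cong (e Fin.zero) (sumFin-cong (λ j → e (Fin.suc j)))

sumFin-zero : ∀ {n} (f : Fin n → Poly) → (∀ j → f j ≋ []) → sumFin f ≋ []
sumFin-zero {zero}  f e = ≋-refl
sumFin-zero {suc n} f e = +P-cong (e Fin.zero) (sumFin-zero (λ j → f (Fin.suc j)) (λ j → e (Fin.suc j)))

sumFin-single : ∀ {n} (f : Fin n → Poly) (j₀ : Fin n) → (∀ j → j ≢ j₀ → f j ≋ []) → sumFin f ≋ f j₀
sumFin-single {suc n} f Fin.zero e =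
  +P-identityʳ (f Fin.zero) (sumFin-zero (λ j → f (Fin.suc j)) (λ j → e (Fin.suc j) (λ ())))
sumFin-single {suc n} f (Fin.suc j₀) e =
  +P-cong (e Fin.zero (λ ())) (sumFin-single (λ j → f (Fin.suc j)) j₀ (λ j j≢j₀ → e (Fin.suc j) (j≢j₀ ∘ FinP.suc-injective)))

sumFin-·P : ∀ {n} a (f : Fin n → Poly) → sumFin (λ j → a ·P f j) ≋ a ·P sumFin f
sumFin-·P {zero}  a f = ≋-refl
sumFin-·P {suc n} a f = coeffwise λ i → begin
  coeff (a ·P f Fin.zero +P sumFin (λ j → a ·P f (Fin.suc j))) i
    ≡⟨ coeff-≡ (+P-cong (≋-refl {a ·P f Fin.zero}) (sumFin-·P a (λ j → f (Fin.suc j)))) i ⟩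
  coeff (a ·P f Fin.zero +P a ·P tail) i
    ≡⟨ coeff-+P (a ·P f Fin.zero) (a ·P tail) i ⟩
  coeff (a ·P f Fin.zero) i ℤ.+ coeff (a ·P tail) i
    ≡⟨ cong₂ ℤ._+_ (coeff-·P a (f Fin.zero) i) (coeff-·P a tail i) ⟩
  a ℤ.* coeff (f Fin.zero) i ℤ.+ a ℤ.* coeff tail i
    ≡⟨ ℤP.*-distribˡ-+ a _ _ ⟨
  a ℤ.* (coeff (f Fin.zero) i ℤ.+ coeff tail i)
    ≡⟨ cong (a ℤ.*_) (coeff-+P (f Fin.zero) tail i) ⟨
  a ℤ.* coeff (sumFin f) i
    ≡⟨ coeff-·P a (sumFin f) i ⟨
  coeff (a ·P sumFin f) i ∎
  where
  open ≡-Reasoning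
  tail : Poly
  tail = sumFin (λ j → f (Fin.suc j))

det-cong : ∀ n {M M′ : Mat n} → (∀ r c → M r c ≋ M′ r c) → det n M ≋ det n M′
det-cong zero    e = ≋-refl
det-cong (suc n) e = sumFin-cong λ j →
  ·P-cong (sign (toℕ j)) (*P-cong (e Fin.zero j) (det-cong n (λ r c → e (Fin.suc r) (punchIn j c))))

cofactor-zeroEntry : ∀ {n} (M : Mat (suc n)) j → M Fin.zero j ≋ [] → cofactor M j ≋ []
cofactor-zeroEntry {n} M j e = ·P-cong (sign (toℕ j)) (*P-zeroˡ (det n (minor j M)) e)

cofactor-zeroMinor : ∀ {n} (M : Mat (suc n)) j → det n (minor j M) ≋ [] → cofactor M j ≋ []
cofactor-zeroMinor M j e = ·P-cong (sign (toℕ j)) (*P-zeroʳ (M Fin.zero j) e)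

cofactor-zero : ∀ {n} (M : Mat (suc n)) → cofactor M Fin.zero ≋ M Fin.zero Fin.zero *P det n (minor Fin.zero M)
cofactor-zero {n} M = ·P-identity (M Fin.zero Fin.zero *P det n (minor Fin.zero M))

det-zeroColumn : ∀ n (M : Mat n) (c : Fin n) → (∀ r → M r c ≋ []) → det n M ≋ []
det-zeroColumn (suc n) M c e = sumFin-zero (cofactor M) term-vanishes
  where
  term-vanishes : ∀ j → cofactor M j ≋ []
  term-vanishes j with j Fin.≟ c
  ... | yes refl = cofactor-zeroEntry M j (e Fin.zero)
  ... | no j≢c   = cofactor-zeroMinor M j (det-zeroColumn n (minor j M) (punchOut j≢c) column-vanishes)
    where
    column-vanishes : ∀ r → minor j M r (punchOut j≢c) ≋ []
    column-vanishes r = subst (λ c′ → M (Fin.suc r) c′ ≋ []) (sym (FinP.punchIn-punchOut j≢c)) (e (Fin.suc r))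

det-row-single : ∀ n (M : Mat (suc n)) (j₀ : Fin (suc n)) →
  (∀ j → j ≢ j₀ → M Fin.zero j ≋ []) → det (suc n) M ≋ cofactor M j₀
det-row-single n M j₀ e = sumFin-single (cofactor M) j₀ (λ j j≢j₀ → cofactor-zeroEntry M j (e j j≢j₀))

det-row-pair : ∀ n (M : Mat (suc n)) (j₀ : Fin n) →
  (∀ j → j ≢ j₀ → M Fin.zero (Fin.suc j) ≋ []) →
  det (suc n) M ≋ cofactor M Fin.zero +P cofactor M (Fin.suc j₀)
det-row-pair n M j₀ e =
  +P-cong ≋-refl (sumFin-single (λ j → cofactor M (Fin.suc j)) j₀ (λ j j≢j₀ → cofactor-zeroEntry M (Fin.suc j) (e j j≢j₀)))

-- Expansion along column 0 when the column vanishes below row 0: every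
-- other minor then contains the vanishing part of column 0.
det-column-single : ∀ n (M : Mat (suc n)) → (∀ r → M (Fin.suc r) Fin.zero ≋ []) →
  det (suc n) M ≋ M Fin.zero Fin.zero *P det n (minor Fin.zero M)
det-column-single zero    M e = ≋-trans (+P-identityʳ (cofactor M Fin.zero) ≋-refl) (cofactor-zero M)
det-column-single (suc n) M e = ≋-trans (sumFin-single (cofactor M) Fin.zero other-terms-vanish) (cofactor-zero M)
  where
  other-terms-vanish : ∀ j → j ≢ Fin.zero → cofactor M j ≋ []
  other-terms-vanish Fin.zero    0≢0 = ⊥-elim (0≢0 refl)
  other-terms-vanish (Fin.suc j) _   = cofactor-zeroMinor M (Fin.suc j) (det-zeroColumn (suc n) (minor (Fin.suc j) M) Fin.zero e)

diagProd : ∀ n → Mat n → Poly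
diagProd zero    M = constP (+ 1)
diagProd (suc n) M = M Fin.zero Fin.zero *P diagProd n (minor Fin.zero M)

-- Expand along column 0
-- while J > 0 and along row 0 once J = 0.
det-blockTriangular : ∀ n (J : ℕ) (M : Mat n) →
  (∀ r c → toℕ c < toℕ r → toℕ c < J → M r c ≋ []) →
  (∀ r c → toℕ r < toℕ c → J ≤ toℕ r → M r c ≋ []) →
  det n M ≋ diagProd n M
det-blockTriangular zero J M lower upper = ≋-refl
det-blockTriangular (suc n) zero M lower upper =
  ≋-trans (det-row-single n M Fin.zero row-vanishes)
    (≋-trans (cofactor-zero M) (*P-congʳ (M Fin.zero Fin.zero) minor-diagonal))
  where
  row-vanishes : ∀ j → j ≢ Fin.zero → M Fin.zero j ≋ []
  row-vanishes Fin.zero    0≢0 = ⊥-elim (0≢0 refl)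
  row-vanishes (Fin.suc j) _   = upper Fin.zero (Fin.suc j) (s≤s z≤n) z≤n
  minor-diagonal : det n (minor Fin.zero M) ≋ diagProd n (minor Fin.zero M)
  minor-diagonal = det-blockTriangular n zero (minor Fin.zero M) (λ _ _ _ ())
    (λ r c r<c _ → upper (Fin.suc r) (Fin.suc c) (s≤s r<c) z≤n)
det-blockTriangular (suc n) (suc J) M lower upper =
  ≋-trans (det-column-single n M (λ r → lower (Fin.suc r) Fin.zero (s≤s z≤n) (s≤s z≤n)))
    (*P-congʳ (M Fin.zero Fin.zero) minor-diagonal)
  where
  minor-diagonal : det n (minor Fin.zero M) ≋ diagProd n (minor Fin.zero M)
  minor-diagonal = det-blockTriangular n J (minor Fin.zero M)
    (λ r c c<r c<J → lower (Fin.suc r) (Fin.suc c) (s≤s c<r) (s≤s c<J))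
    (λ r c r<c J≤r → upper (Fin.suc r) (Fin.suc c) (s≤s r<c) (s≤s J≤r))

diagProd-X-then-minusOne : ∀ q J (M : Mat q) → J ≤ q →
  (∀ i → toℕ i < J → M i i ≋ X) → (∀ i → J ≤ toℕ i → M i i ≋ constP -1ℤ) →
  diagProd q M ≋ sign (q ∸ J) ·P X^ J
diagProd-X-then-minusOne zero zero M z≤n isX isMinusOne = ≋-sym (·P-identity (X^ 0))
diagProd-X-then-minusOne (suc q) zero M z≤n isX isMinusOne = begin
  M Fin.zero Fin.zero *P diagProd q (minor Fin.zero M)  ≈⟨ *P-cong (isMinusOne Fin.zero z≤n) rest ⟩
  constP -1ℤ *P (sign q ·P X^ 0)                        ≈⟨ minusOne-*P-sign q (X^ 0) ⟩
  sign (suc q) ·P X^ 0                                  ∎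
  where
  open ≋-Reasoning
  rest : diagProd q (minor Fin.zero M) ≋ sign q ·P X^ 0
  rest = diagProd-X-then-minusOne q zero (minor Fin.zero M) z≤n (λ _ ()) (λ i _ → isMinusOne (Fin.suc i) z≤n)
diagProd-X-then-minusOne (suc q) (suc J) M (s≤s J≤q) isX isMinusOne = begin
  M Fin.zero Fin.zero *P diagProd q (minor Fin.zero M)  ≈⟨ *P-cong (isX Fin.zero (s≤s z≤n)) rest ⟩
  X *P (sign (q ∸ J) ·P X^ J)                           ≈⟨ *P-·P X (sign (q ∸ J)) (X^ J) ⟩
  sign (q ∸ J) ·P (X *P X^ J)                           ≈⟨ ·P-cong (sign (q ∸ J)) (X-*P (X^ J)) ⟩
  sign (q ∸ J) ·P X^ (suc J)                            ∎
  where
  open ≋-Reasoning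
  rest : diagProd q (minor Fin.zero M) ≋ sign (q ∸ J) ·P X^ J
  rest = diagProd-X-then-minusOne q J (minor Fin.zero M) J≤q
    (λ i i<J → isX (Fin.suc i) (s≤s i<J)) (λ i J≤i → isMinusOne (Fin.suc i) (s≤s J≤i))

det-upperTriangular-X : ∀ q (M : Mat q) → (∀ r c → toℕ c < toℕ r → M r c ≋ []) →
  (∀ i → M i i ≋ X) → det q M ≋ X^ q
det-upperTriangular-X q M lower diagonal = begin
  det q M              ≈⟨ det-blockTriangular q q M (λ r c c<r _ → lower r c c<r) no-upper-block ⟩
  diagProd q M         ≈⟨ diagProd-X-then-minusOne q q M ℕP.≤-refl (λ i _ → diagonal i) no-minusOne ⟩
  sign (q ∸ q) ·P X^ q ≡⟨ cong (λ k → sign k ·P X^ q) (ℕP.n∸n≡0 q) ⟩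
  sign 0 ·P X^ q       ≈⟨ ·P-identity (X^ q) ⟩
  X^ q                 ∎
  where
  open ≋-Reasoning
  no-upper-block : ∀ r c → toℕ r < toℕ c → q ≤ toℕ r → M r c ≋ []
  no-upper-block r c _ q≤r = ⊥-elim (ℕP.<⇒≱ (FinP.toℕ<n r) q≤r)
  no-minusOne : ∀ i → q ≤ toℕ i → M i i ≋ constP -1ℤ
  no-minusOne i q≤i = ⊥-elim (ℕP.<⇒≱ (FinP.toℕ<n i) q≤i)

cornerMinor : ∀ {m} → Mat (suc (suc m)) → Mat (suc m)
cornerMinor T r c = T (inject₁ r) (Fin.suc c)

-- Expansion along column 0 when that column vanishes except in the first
-- row and in the last row, where it holds a constant c:
--   det T = T₀₀ · det (minor 0 T) + (-1)^(m+1) · c · det (cornerMinor T).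
-- det expands along row 0; the minors of the terms j ≥ 1 have the same
-- shape one size smaller, so the two lemmas below are proved together.
det-column-corner : ∀ m (T : Mat (suc (suc m))) (c : ℤ) →
  (∀ (r : Fin m) → T (Fin.suc (inject₁ r)) Fin.zero ≋ []) →
  T (fromℕ (suc m)) Fin.zero ≋ constP c →
  det (suc (suc m)) T ≋
    T Fin.zero Fin.zero *P det (suc m) (minor Fin.zero T) +P sign (suc m) ·P (c ·P det (suc m) (cornerMinor T))

-- The minor of the j+1-st term: its column 0 is the rest of column 0 of T,
-- so only the corner survives.
det-minor-corner : ∀ m (T : Mat (suc (suc m))) (c : ℤ) →
  (∀ (r : Fin m) → T (Fin.suc (inject₁ r)) Fin.zero ≋ []) →
  T (fromℕ (suc m)) Fin.zero ≋ constP c →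
  ∀ j → det (suc m) (minor (Fin.suc j) T) ≋ sign m ·P (c ·P det m (minor j (cornerMinor T)))
det-minor-corner zero T c interior corner Fin.zero = begin
  det 1 (minor (Fin.suc Fin.zero) T)    ≈⟨ +P-identityʳ (cofactor (minor (Fin.suc Fin.zero) T) Fin.zero) ≋-refl ⟩
  cofactor (minor (Fin.suc Fin.zero) T) Fin.zero  ≈⟨ cofactor-zero (minor (Fin.suc Fin.zero) T) ⟩
  T (Fin.suc Fin.zero) Fin.zero *P constP (+ 1)   ≈⟨ *P-congˡ (constP (+ 1)) corner ⟩
  constP c *P constP (+ 1)              ≈⟨ constP-*P c (constP (+ 1)) ⟩
  c ·P constP (+ 1)                     ≈⟨ ·P-identity (c ·P constP (+ 1)) ⟨
  sign 0 ·P (c ·P constP (+ 1))         ∎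
  where open ≋-Reasoning
det-minor-corner (suc m) T c interior corner j = begin
  det (suc (suc m)) N
    ≈⟨ det-column-corner m N c (λ r → interior (Fin.suc r)) corner ⟩
  N Fin.zero Fin.zero *P det (suc m) (minor Fin.zero N) +P sign (suc m) ·P (c ·P det (suc m) (cornerMinor N))
    ≈⟨ +P-cong (*P-zeroˡ (det (suc m) (minor Fin.zero N)) (interior Fin.zero)) ≋-refl ⟩
  sign (suc m) ·P (c ·P det (suc m) (minor j (cornerMinor T)))
    ∎
  where
  open ≋-Reasoning
  N : Mat (suc (suc m))
  N = minor (Fin.suc j) T

det-column-corner m T c interior corner = begin
  cofactor T Fin.zero +P sumFin (λ j → cofactor T (Fin.suc j))
    ≈⟨ +P-cong (cofactor-zero T) (sumFin-cong later-term) ⟩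
  T₀₀minor +P sumFin (λ j → (sign (suc m) ℤ.* c) ·P cofactor T′ j)
    ≈⟨ +P-cong (≋-refl {T₀₀minor}) (sumFin-·P (sign (suc m) ℤ.* c) (cofactor T′)) ⟩
  T₀₀minor +P (sign (suc m) ℤ.* c) ·P det (suc m) T′
    ≈⟨ +P-cong (≋-refl {T₀₀minor}) (≋-sym (·P-assoc (sign (suc m)) c (det (suc m) T′))) ⟩
  T₀₀minor +P sign (suc m) ·P (c ·P det (suc m) T′)
    ∎
  where
  open ≋-Reasoning
  T′ : Mat (suc m)
  T′ = cornerMinor T
  T₀₀minor : Poly
  T₀₀minor = T Fin.zero Fin.zero *P det (suc m) (minor Fin.zero T)
  later-term : ∀ j → cofactor T (Fin.suc j) ≋ (sign (suc m) ℤ.* c) ·P cofactor T′ j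
  later-term j = begin
    sign (suc (toℕ j)) ·P (e *P det (suc m) (minor (Fin.suc j) T))
      ≈⟨ ·P-cong (sign (suc (toℕ j))) (*P-congʳ e (det-minor-corner m T c interior corner j)) ⟩
    sign (suc (toℕ j)) ·P (e *P (sign m ·P (c ·P D)))
      ≈⟨ ·P-cong (sign (suc (toℕ j))) (*P-·P e (sign m) (c ·P D)) ⟩
    sign (suc (toℕ j)) ·P (sign m ·P (e *P (c ·P D)))
      ≈⟨ ·P-cong (sign (suc (toℕ j))) (·P-cong (sign m) (*P-·P e c D)) ⟩
    sign (suc (toℕ j)) ·P (sign m ·P (c ·P (e *P D)))
      ≈⟨ ·P-cong (sign (suc (toℕ j))) (·P-assoc (sign m) c (e *P D)) ⟩
    sign (suc (toℕ j)) ·P ((sign m ℤ.* c) ·P (e *P D))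
      ≈⟨ ·P-assoc (sign (suc (toℕ j))) (sign m ℤ.* c) (e *P D) ⟩
    (sign (suc (toℕ j)) ℤ.* (sign m ℤ.* c)) ·P (e *P D)
      ≡⟨ cong (_·P (e *P D)) (regroup (sign (toℕ j)) (sign m) c) ⟩
    ((sign (suc m) ℤ.* c) ℤ.* sign (toℕ j)) ·P (e *P D)
      ≈⟨ ·P-assoc (sign (suc m) ℤ.* c) (sign (toℕ j)) (e *P D) ⟨
    (sign (suc m) ℤ.* c) ·P (sign (toℕ j) ·P (e *P D))
      ∎
    where
    e : Poly
    e = T Fin.zero (Fin.suc j)
    D : Poly
    D = det m (minor j T′)
    regroup : ∀ s t c → (- s) ℤ.* (t ℤ.* c) ≡ ((- t) ℤ.* c) ℤ.* s
    regroup = solve-∀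

toℕ-punchIn-below : ∀ {n} (j : Fin (suc n)) (c : Fin n) → toℕ c < toℕ j → toℕ (punchIn j c) ≡ toℕ c
toℕ-punchIn-below (Fin.suc j) Fin.zero    c<j       = refl
toℕ-punchIn-below (Fin.suc j) (Fin.suc c) (s≤s c<j) = cong suc (toℕ-punchIn-below j c c<j)

toℕ-punchIn-above : ∀ {n} (j : Fin (suc n)) (c : Fin n) → toℕ j ≤ toℕ c → toℕ (punchIn j c) ≡ suc (toℕ c)
toℕ-punchIn-above Fin.zero    c           j≤c       = refl
toℕ-punchIn-above (Fin.suc j) (Fin.suc c) (s≤s j≤c) = cong suc (toℕ-punchIn-above j c j≤c)

descendingPowers : ℕ → ℕ → Poly
descendingPowers J zero    = []
descendingPowers J (suc h) = X^ J +P descendingPowers (J ∸ 2) h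

-- The bound 2h ≤ J + 1 keeps the chords above the diagonal.
record ChordMatrix (p J h : ℕ) (N : Mat p) : Set where
  field
    room        : 2 * h ≤ suc J
    inRange     : 0 < h → J < p
    diagonal    : ∀ r c → toℕ r ≡ toℕ c → N r c ≋ constP -1ℤ
    subdiagonal : ∀ r c → toℕ r ≡ suc (toℕ c) → N r c ≋ X
    chord       : ∀ r c → toℕ r < h → toℕ r + toℕ c ≡ J → N r c ≋ constP -1ℤ
    elsewhere   : ∀ r c → toℕ r ≢ toℕ c → toℕ r ≢ suc (toℕ c) →
                  (toℕ r < h → toℕ r + toℕ c ≢ J) → N r c ≋ []

chord-above : ∀ {h J r c} → 2 * h ≤ suc J → r < h → r + c ≡ J → r < c
chord-above {h} {J} {r} {c} room r<h r+c≡J = ℕP.+-cancelˡ-≤ r (suc r) c (ℕP.≤-pred bound)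
  where
  double-suc : ∀ r → 2 * suc r ≡ suc (r + suc r)
  double-suc = ℕSolver.solve-∀
  bound : suc (r + suc r) ≤ suc (r + c)
  bound = subst₂ _≤_ (double-suc r) (cong suc (sym r+c≡J)) (ℕP.≤-trans (ℕP.*-monoʳ-≤ 2 r<h) room)

room-large : ∀ {h J} → 2 * h ≤ suc J → 1 < h → 2 ≤ J
room-large room 1<h = ℕP.≤-pred (ℕP.≤-trans (s≤s (s≤s (s≤s z≤n))) (ℕP.≤-trans (ℕP.*-monoʳ-≤ 2 1<h) room))

room-minor : ∀ {h J} → 2 * h ≤ suc J → 2 * (h ∸ 1) ≤ suc (J ∸ 2)
room-minor {h} {J} room = begin
  2 * (h ∸ 1)  ≡⟨ ℕP.*-distribˡ-∸ 2 h 1 ⟩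
  2 * h ∸ 2    ≤⟨ ℕP.∸-monoˡ-≤ 2 room ⟩
  J ∸ 1        ≤⟨ pred-bound J ⟩
  suc (J ∸ 2)  ∎
  where
  open ℕP.≤-Reasoning
  pred-bound : ∀ J → J ∸ 1 ≤ suc (J ∸ 2)
  pred-bound zero    = z≤n
  pred-bound (suc J) = ℕP.m≤n+m∸n J 1

suc<⇒<∸1 : ∀ {r h} → suc r < h → r < h ∸ 1
suc<⇒<∸1 {h = suc h} r<h = ℕP.≤-pred r<h

<∸1⇒suc< : ∀ {r h} → r < h ∸ 1 → suc r < h
<∸1⇒suc< {h = suc h} r<h = s≤s r<h

chord-shift : ∀ {r c J} → 2 ≤ J → r + c ≡ J ∸ 2 → suc r + suc c ≡ J
chord-shift {r} {c} {suc (suc J)} (s≤s (s≤s z≤n)) r+c≡J = cong suc (trans (ℕP.+-suc r c) (cong suc r+c≡J))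

chord-unshift : ∀ {r c J} → suc r + suc c ≡ J → r + c ≡ J ∸ 2
chord-unshift {r} {c} refl = cong (_∸ 1) (sym (ℕP.+-suc r c))

chordMatrix-minor₀ : ∀ {p J h N} → ChordMatrix (suc p) J h N → ChordMatrix p (J ∸ 2) (h ∸ 1) (minor Fin.zero N)
chordMatrix-minor₀ {p} {J} {h} {N} ch = record
  { room        = room-minor {h} room
  ; inRange     = minor-inRange
  ; diagonal    = λ r c e → diagonal (Fin.suc r) (Fin.suc c) (cong suc e)
  ; subdiagonal = λ r c e → subdiagonal (Fin.suc r) (Fin.suc c) (cong suc e)
  ; chord       = λ r c r<h∸1 e → chord (Fin.suc r) (Fin.suc c) (<∸1⇒suc< r<h∸1)
                                    (chord-shift (room-large room (two-chords r<h∸1)) e)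
  ; elsewhere   = λ r c r≢c r≢1+c not-chord → elsewhere (Fin.suc r) (Fin.suc c)
                    (r≢c ∘ ℕP.suc-injective) (r≢1+c ∘ ℕP.suc-injective)
                    (λ 1+r<h e → not-chord (suc<⇒<∸1 1+r<h) (chord-unshift e))
  }
  where
  open ChordMatrix ch
  two-chords : ∀ {r} → r < h ∸ 1 → 1 < h
  two-chords r<h∸1 = ℕP.≤-trans (s≤s (s≤s z≤n)) (<∸1⇒suc< r<h∸1)
  minor-inRange : 0 < h ∸ 1 → J ∸ 2 < p
  minor-inRange 0<h∸1 with room-large room (two-chords 0<h∸1) | inRange (ℕP.≤-trans (s≤s z≤n) (two-chords 0<h∸1))
  ... | 2≤J | J<1+p = ℕP.≤-trans (ℕP.n≤1+n _) (ℕP.≤-pred (subst (_< suc p) (sym (ℕP.m+[n∸m]≡n 2≤J)) J<1+p))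

-- Deleting row 0 and a column J of a chord matrix leaves a block triangular
-- matrix whose diagonal is x in its first J places (the old subdiagonal)
-- and -1 afterwards (the old diagonal).
det-chordMatrix-columnMinor : ∀ {p J h N} → ChordMatrix (suc p) J h N →
  (j : Fin (suc p)) → toℕ j ≡ J → det p (minor j N) ≋ sign (p ∸ J) ·P X^ J
det-chordMatrix-columnMinor {p} {J} {h} {N} ch j toℕj≡J =
  ≋-trans (det-blockTriangular p J Q lower upper) (diagProd-X-then-minusOne p J Q J≤p leading trailing)
  where
  open ChordMatrix ch
  Q : Mat p
  Q = minor j N
  J≤p : J ≤ p
  J≤p = subst (_≤ p) toℕj≡J (ℕP.≤-pred (FinP.toℕ<n j))
  column-below : ∀ b → toℕ b < J → toℕ (punchIn j b) ≡ toℕ b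
  column-below b b<J = toℕ-punchIn-below j b (subst (toℕ b <_) (sym toℕj≡J) b<J)
  column-above : ∀ b → J ≤ toℕ b → toℕ (punchIn j b) ≡ suc (toℕ b)
  column-above b J≤b = toℕ-punchIn-above j b (subst (_≤ toℕ b) (sym toℕj≡J) J≤b)
  lower : ∀ a b → toℕ b < toℕ a → toℕ b < J → Q a b ≋ []
  lower a b b<a b<J = elsewhere (Fin.suc a) (punchIn j b)
    (λ e → ℕP.>⇒≢ (ℕP.m<n⇒m<1+n b<a) (trans e col))
    (λ e → ℕP.>⇒≢ b<a (ℕP.suc-injective (trans e (cong suc col))))
    (λ 1+a<h e → ℕP.<-asym (ℕP.≤-trans (ℕP.n≤1+n _) (subst (suc (toℕ a) <_) col (chord-above room 1+a<h e))) b<a)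
    where
    col : toℕ (punchIn j b) ≡ toℕ b
    col = column-below b b<J
  upper : ∀ a b → toℕ a < toℕ b → J ≤ toℕ a → Q a b ≋ []
  upper a b a<b J≤a = elsewhere (Fin.suc a) (punchIn j b)
    (λ e → ℕP.<⇒≢ a<b (ℕP.suc-injective (trans e col)))
    (λ e → ℕP.<⇒≢ (ℕP.m<n⇒m<1+n a<b) (ℕP.suc-injective (trans e (cong suc col))))
    (λ _ e → ℕP.<-irrefl (sym (trans (cong (λ k → suc (toℕ a) + k) (sym col)) e))
                         (s≤s (ℕP.≤-trans J≤a (ℕP.m≤m+n (toℕ a) (suc (toℕ b))))))
    where
    col : toℕ (punchIn j b) ≡ suc (toℕ b)
    col = column-above b (ℕP.≤-trans J≤a (ℕP.<⇒≤ a<b))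
  leading : ∀ a → toℕ a < J → Q a a ≋ X
  leading a a<J = subdiagonal (Fin.suc a) (punchIn j a) (cong suc (sym (column-below a a<J)))
  trailing : ∀ a → J ≤ toℕ a → Q a a ≋ constP -1ℤ
  trailing a J≤a = diagonal (Fin.suc a) (punchIn j a) (sym (column-above a J≤a))

-- The polynomial identity combining the two terms of a row-0 expansion of
-- a chord matrix, given s_J · s_(p-J) = s_p.
chordStep-algebra : ∀ sJ sq {sp} → sJ ℤ.* sq ≡ sp → ∀ P D E →
  -1ℤ ·P (sp ·P (D +P E)) +P sJ ·P (-1ℤ ·P (sq ·P P)) ≋ (- sp) ·P ((P +P D) +P E)
chordStep-algebra sJ sq refl P D E = coeffwise λ i → begin
  coeff (-1ℤ ·P ((sJ ℤ.* sq) ·P (D +P E)) +P sJ ·P (-1ℤ ·P (sq ·P P))) i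
    ≡⟨ coeff-+P (-1ℤ ·P ((sJ ℤ.* sq) ·P (D +P E))) (sJ ·P (-1ℤ ·P (sq ·P P))) i ⟩
  coeff (-1ℤ ·P ((sJ ℤ.* sq) ·P (D +P E))) i ℤ.+ coeff (sJ ·P (-1ℤ ·P (sq ·P P))) i
    ≡⟨ cong₂ ℤ._+_ (coeff-·P-·P -1ℤ (sJ ℤ.* sq) (D +P E) i) (trans (coeff-·P sJ (-1ℤ ·P (sq ·P P)) i) (cong (sJ ℤ.*_) (coeff-·P-·P -1ℤ sq P i))) ⟩
  -1ℤ ℤ.* (sJ ℤ.* sq ℤ.* coeff (D +P E) i) ℤ.+ sJ ℤ.* (-1ℤ ℤ.* (sq ℤ.* coeff P i))
    ≡⟨ cong (λ v → -1ℤ ℤ.* (sJ ℤ.* sq ℤ.* v) ℤ.+ sJ ℤ.* (-1ℤ ℤ.* (sq ℤ.* coeff P i))) (coeff-+P D E i) ⟩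
  -1ℤ ℤ.* (sJ ℤ.* sq ℤ.* (coeff D i ℤ.+ coeff E i)) ℤ.+ sJ ℤ.* (-1ℤ ℤ.* (sq ℤ.* coeff P i))
    ≡⟨ identity sJ sq (coeff P i) (coeff D i) (coeff E i) ⟩
  (- (sJ ℤ.* sq)) ℤ.* ((coeff P i ℤ.+ coeff D i) ℤ.+ coeff E i)
    ≡⟨ cong (λ v → (- (sJ ℤ.* sq)) ℤ.* (v ℤ.+ coeff E i)) (coeff-+P P D i) ⟨
  (- (sJ ℤ.* sq)) ℤ.* (coeff (P +P D) i ℤ.+ coeff E i)
    ≡⟨ cong ((- (sJ ℤ.* sq)) ℤ.*_) (coeff-+P (P +P D) E i) ⟨
  (- (sJ ℤ.* sq)) ℤ.* coeff ((P +P D) +P E) i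
    ≡⟨ coeff-·P (- (sJ ℤ.* sq)) ((P +P D) +P E) i ⟨
  coeff ((- (sJ ℤ.* sq)) ·P ((P +P D) +P E)) i
    ∎
  where
  open ≡-Reasoning
  coeff-·P-·P : ∀ a b p i → coeff (a ·P (b ·P p)) i ≡ a ℤ.* (b ℤ.* coeff p i)
  coeff-·P-·P a b p i = trans (coeff-·P a (b ·P p) i) (cong (a ℤ.*_) (coeff-·P b p i))
  identity : ∀ s t x d e → -1ℤ ℤ.* (s ℤ.* t ℤ.* (d ℤ.+ e)) ℤ.+ s ℤ.* (-1ℤ ℤ.* (t ℤ.* x))
                         ≡ (- (s ℤ.* t)) ℤ.* ((x ℤ.+ d) ℤ.+ e)
  identity = solve-∀

-- The determinant of a chord matrix, by induction along row 0: for h = 0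
-- it is (-1)^p; otherwise row 0 holds -1 in column 0 (minor: a chord
-- matrix with one chord less) and -1 in column J (minor: block triangular).
det-chordMatrix : ∀ p J h (N : Mat p) → ChordMatrix p J h N →
  det p N ≋ sign p ·P (descendingPowers J h +P constP (+ 1))
det-chordMatrix zero    J zero    N ch = ≋-sym (·P-identity (constP (+ 1)))
det-chordMatrix zero    J (suc h) N ch = ⊥-elim (ℕP.n≮0 (ChordMatrix.inRange ch (s≤s z≤n)))
det-chordMatrix (suc p) J zero N ch = begin
  det (suc p) N                                    ≈⟨ det-row-single p N Fin.zero row-vanishes ⟩
  cofactor N Fin.zero                              ≈⟨ cofactor-zero N ⟩
  N Fin.zero Fin.zero *P det p (minor Fin.zero N)  ≈⟨ *P-cong (diagonal Fin.zero Fin.zero refl) minor-det ⟩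
  constP -1ℤ *P (sign p ·P constP (+ 1))           ≈⟨ minusOne-*P-sign p (constP (+ 1)) ⟩
  sign (suc p) ·P constP (+ 1)                     ∎
  where
  open ChordMatrix ch
  open ≋-Reasoning
  row-vanishes : ∀ j → j ≢ Fin.zero → N Fin.zero j ≋ []
  row-vanishes Fin.zero    0≢0 = ⊥-elim (0≢0 refl)
  row-vanishes (Fin.suc j) _   = elsewhere Fin.zero (Fin.suc j) (λ ()) (λ ()) (λ ())
  minor-det : det p (minor Fin.zero N) ≋ sign p ·P constP (+ 1)
  minor-det = det-chordMatrix p (J ∸ 2) zero (minor Fin.zero N) (chordMatrix-minor₀ ch)
det-chordMatrix (suc p) zero (suc h) N ch =
  ⊥-elim (ℕP.<⇒≱ (ℕP.*-monoʳ-≤ 2 (s≤s (z≤n {h}))) (ChordMatrix.room ch))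
det-chordMatrix (suc p) (suc J′) (suc h) N ch = begin
  det (suc p) N
    ≈⟨ det-row-pair p N j₀ row-vanishes ⟩
  cofactor N Fin.zero +P cofactor N (Fin.suc j₀)
    ≈⟨ +P-cong diagonal-term chord-term ⟩
  -1ℤ ·P (sign p ·P (descendingPowers (J ∸ 2) h +P constP (+ 1))) +P sign J ·P (-1ℤ ·P (sign (p ∸ J) ·P X^ J))
    ≈⟨ chordStep-algebra (sign J) (sign (p ∸ J)) signs (X^ J) (descendingPowers (J ∸ 2) h) (constP (+ 1)) ⟩
  sign (suc p) ·P (descendingPowers J (suc h) +P constP (+ 1))
    ∎
  where
  open ChordMatrix ch
  open ≋-Reasoning
  J : ℕ
  J = suc J′
  J≤p : J ≤ p
  J≤p = ℕP.≤-pred (inRange (s≤s z≤n))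
  j₀ : Fin p
  j₀ = Fin.fromℕ< J≤p
  toℕ-chordColumn : toℕ (Fin.suc j₀) ≡ J
  toℕ-chordColumn = cong suc (FinP.toℕ-fromℕ< J≤p)
  row-vanishes : ∀ j → j ≢ j₀ → N Fin.zero (Fin.suc j) ≋ []
  row-vanishes j j≢j₀ = elsewhere Fin.zero (Fin.suc j) (λ ()) (λ ())
    (λ _ e → j≢j₀ (FinP.toℕ-injective (ℕP.suc-injective (trans e (sym toℕ-chordColumn)))))
  diagonal-term : cofactor N Fin.zero ≋ -1ℤ ·P (sign p ·P (descendingPowers (J ∸ 2) h +P constP (+ 1)))
  diagonal-term = begin
    cofactor N Fin.zero
      ≈⟨ cofactor-zero N ⟩
    N Fin.zero Fin.zero *P det p (minor Fin.zero N)
      ≈⟨ *P-cong (diagonal Fin.zero Fin.zero refl) (det-chordMatrix p (J ∸ 2) h (minor Fin.zero N) (chordMatrix-minor₀ ch)) ⟩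
    constP -1ℤ *P (sign p ·P (descendingPowers (J ∸ 2) h +P constP (+ 1)))
      ≈⟨ constP-*P -1ℤ (sign p ·P (descendingPowers (J ∸ 2) h +P constP (+ 1))) ⟩
    -1ℤ ·P (sign p ·P (descendingPowers (J ∸ 2) h +P constP (+ 1)))
      ∎
  chord-term : cofactor N (Fin.suc j₀) ≋ sign J ·P (-1ℤ ·P (sign (p ∸ J) ·P X^ J))
  chord-term = begin
    sign (toℕ (Fin.suc j₀)) ·P (N Fin.zero (Fin.suc j₀) *P det p (minor (Fin.suc j₀) N))
      ≡⟨ cong (λ k → sign k ·P (N Fin.zero (Fin.suc j₀) *P det p (minor (Fin.suc j₀) N))) toℕ-chordColumn ⟩
    sign J ·P (N Fin.zero (Fin.suc j₀) *P det p (minor (Fin.suc j₀) N))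
      ≈⟨ ·P-cong (sign J) (*P-cong (chord Fin.zero (Fin.suc j₀) (s≤s z≤n) toℕ-chordColumn)
                                  (det-chordMatrix-columnMinor ch (Fin.suc j₀) toℕ-chordColumn)) ⟩
    sign J ·P (constP -1ℤ *P (sign (p ∸ J) ·P X^ J))
      ≈⟨ ·P-cong (sign J) (constP-*P -1ℤ (sign (p ∸ J) ·P X^ J)) ⟩
    sign J ·P (-1ℤ ·P (sign (p ∸ J) ·P X^ J))
      ∎
  signs : sign J ℤ.* sign (p ∸ J) ≡ sign p
  signs = trans (sym (sign-+ J (p ∸ J))) (cong sign (ℕP.m+[n∸m]≡n J≤p))

≡ᵇ-refl : ∀ n → (n ≡ᵇ n) ≡ true
≡ᵇ-refl zero    = refl
≡ᵇ-refl (suc n) = ≡ᵇ-refl n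

countArcs-hit : ∀ s t as → countArcs ((s , t) ∷ as) s t ≡ suc (countArcs as s t)
countArcs-hit s t as rewrite ≡ᵇ-refl s | ≡ᵇ-refl t = refl

countArcs-miss : ∀ s t as a b → (s ≡ a → t ≢ b) → countArcs ((s , t) ∷ as) a b ≡ countArcs as a b
countArcs-miss s t as a b other-arc with s ≡ᵇ a in s≡ᵇa | t ≡ᵇ b in t≡ᵇb
... | true  | true  = ⊥-elim (other-arc (ℕP.≡ᵇ⇒≡ s a (subst T (sym s≡ᵇa) tt)) (ℕP.≡ᵇ⇒≡ t b (subst T (sym t≡ᵇb) tt)))
... | true  | false = refl
... | false | _     = refl

countArcs-++ : ∀ as bs a b → countArcs (as ++ bs) a b ≡ countArcs as a b + countArcs bs a b
countArcs-++ []             bs a b = refl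
countArcs-++ ((s , t) ∷ as) bs a b =
  trans (cong (λ k → (if (s ≡ᵇ a) ∧ (t ≡ᵇ b) then 1 else 0) + k) (countArcs-++ as bs a b))
        (sym (ℕP.+-assoc (if (s ≡ᵇ a) ∧ (t ≡ᵇ b) then 1 else 0) _ _))

graphArcs : (ℕ → ℕ) → ℕ → Arcs
graphArcs g L = map (λ t → (t , g t)) (oneTo L)

graphArcs-suc : ∀ g L a b →
  countArcs (graphArcs g (suc L)) a b ≡ countArcs (graphArcs g L) a b + countArcs ((suc L , g (suc L)) ∷ []) a b
graphArcs-suc g L a b = begin
  countArcs (graphArcs g (suc L)) a b
    ≡⟨ cong (λ ts → countArcs (map (λ t → (t , g t)) ts) a b) oneTo-suc ⟩
  countArcs (map (λ t → (t , g t)) (oneTo L ++ (suc L ∷ []))) a b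
    ≡⟨ cong (λ as → countArcs as a b) (LP.map-++ (λ t → (t , g t)) (oneTo L) (suc L ∷ [])) ⟩
  countArcs (graphArcs g L ++ ((suc L , g (suc L)) ∷ [])) a b
    ≡⟨ countArcs-++ (graphArcs g L) ((suc L , g (suc L)) ∷ []) a b ⟩
  countArcs (graphArcs g L) a b + countArcs ((suc L , g (suc L)) ∷ []) a b
    ∎
  where
  open ≡-Reasoning
  oneTo-suc : oneTo (suc L) ≡ oneTo L ++ (suc L ∷ [])
  oneTo-suc = trans (cong (map suc) (sym (LP.upTo-∷ʳ L))) (LP.map-++ suc (upTo L) (L ∷ []))

graphArcs-miss : ∀ g L a b → (1 ≤ a → a ≤ L → g a ≢ b) → countArcs (graphArcs g L) a b ≡ 0
graphArcs-miss g zero    a b off-graph = refl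
graphArcs-miss g (suc L) a b off-graph = begin
  countArcs (graphArcs g (suc L)) a b                                    ≡⟨ graphArcs-suc g L a b ⟩
  countArcs (graphArcs g L) a b + countArcs ((suc L , g (suc L)) ∷ []) a b ≡⟨ cong₂ _+_ earlier last ⟩
  0                                                                      ∎
  where
  open ≡-Reasoning
  earlier : countArcs (graphArcs g L) a b ≡ 0
  earlier = graphArcs-miss g L a b (λ 1≤a a≤L → off-graph 1≤a (ℕP.m≤n⇒m≤1+n a≤L))
  last : countArcs ((suc L , g (suc L)) ∷ []) a b ≡ 0
  last = countArcs-miss (suc L) (g (suc L)) [] a b λ { refl → off-graph (s≤s z≤n) ℕP.≤-refl }

graphArcs-hit : ∀ g L a → 1 ≤ a → a ≤ L → countArcs (graphArcs g L) a (g a) ≡ 1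
graphArcs-hit g zero    (suc a) 1≤a ()
graphArcs-hit g (suc L) a 1≤a a≤1+L with ℕP.m≤n⇒m<n∨m≡n a≤1+L
... | inj₁ a<1+L = trans (graphArcs-suc g L a (g a))
  (cong₂ _+_ (graphArcs-hit g L a 1≤a (ℕP.≤-pred a<1+L))
             (countArcs-miss (suc L) (g (suc L)) [] a (g a) (λ { refl _ → ℕP.<-irrefl refl a<1+L })))
... | inj₂ refl  = trans (graphArcs-suc g L a (g a))
  (cong₂ _+_ (graphArcs-miss g L a (g a) (λ _ a≤L _ → ℕP.<-irrefl refl a≤L))
             (countArcs-hit a (g a) []))

chordCount : ℕ → ℕ
chordCount n = n / 2 ∸ 1

chord-gap : ∀ n {t} → 1 ≤ t → t ≤ chordCount n → 2 + t ≤ n ∸ t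
chord-gap n {t} 1≤t t≤k = ℕP.m+n≤o⇒m≤o∸n (2 + t) (begin
  2 + t + t   ≡⟨ double-suc t ⟩
  suc t * 2   ≤⟨ ℕP.*-monoˡ-≤ 2 (below-half {t} {n / 2} 1≤t t≤k) ⟩
  n / 2 * 2   ≤⟨ m/n*n≤m n 2 ⟩
  n           ∎)
  where
  open ℕP.≤-Reasoning
  double-suc : ∀ t → 2 + t + t ≡ suc t * 2
  double-suc = ℕSolver.solve-∀
  below-half : ∀ {t h} → 1 ≤ t → t ≤ h ∸ 1 → suc t ≤ h
  below-half {suc t} {zero}  _ ()
  below-half {t}     {suc h} _ t≤h = s≤s t≤h

chord-lands-far : ∀ n {a b} → 1 ≤ a → a ≤ chordCount n → n ∸ a ≡ b → b ≤ suc a → ⊥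
chord-lands-far n {a} 1≤a a≤k n∸a≡b b≤1+a =
  ℕP.n≮n (suc a) (ℕP.≤-trans (subst (2 + a ≤_) n∸a≡b (chord-gap n 1≤a a≤k)) b≤1+a)

DC-count : ∀ n a b → countArcs (DC n) a b ≡
  countArcs (graphArcs suc (n ∸ 1)) a b + (countArcs ((n , 1) ∷ []) a b + countArcs (graphArcs (n ∸_) (chordCount n)) a b)
DC-count n a b = trans (countArcs-++ (graphArcs suc (n ∸ 1)) (((n , 1) ∷ []) ++ chords) a b)
  (cong (λ k → countArcs (graphArcs suc (n ∸ 1)) a b + k) (countArcs-++ ((n , 1) ∷ []) chords a b))
  where
  chords : Arcs
  chords = graphArcs (n ∸_) (chordCount n)

DC-noArc : ∀ n a b → b ≢ suc a → (a ≡ n → b ≢ 1) → (1 ≤ a → a ≤ chordCount n → n ∸ a ≢ b) →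
  countArcs (DC n) a b ≡ 0
DC-noArc n a b not-path not-closing not-chord = trans (DC-count n a b) (cong₂ _+_ path (cong₂ _+_ closing chords))
  where
  path : countArcs (graphArcs suc (n ∸ 1)) a b ≡ 0
  path = graphArcs-miss suc (n ∸ 1) a b (λ _ _ e → not-path (sym e))
  closing : countArcs ((n , 1) ∷ []) a b ≡ 0
  closing = countArcs-miss n 1 [] a b (λ n≡a e → not-closing (sym n≡a) (sym e))
  chords : countArcs (graphArcs (n ∸_) (chordCount n)) a b ≡ 0
  chords = graphArcs-miss (n ∸_) (chordCount n) a b not-chord

DC-pathArc : ∀ n a → 1 ≤ a → a ≤ n ∸ 1 → countArcs (DC n) a (suc a) ≡ 1
DC-pathArc n a 1≤a a≤n-1 = trans (DC-count n a (suc a)) (cong₂ _+_ path (cong₂ _+_ closing chords))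
  where
  path : countArcs (graphArcs suc (n ∸ 1)) a (suc a) ≡ 1
  path = graphArcs-hit suc (n ∸ 1) a 1≤a a≤n-1
  closing : countArcs ((n , 1) ∷ []) a (suc a) ≡ 0
  closing = countArcs-miss n 1 [] a (suc a) (λ { _ refl → ℕP.<-irrefl refl 1≤a })
  chords : countArcs (graphArcs (n ∸_) (chordCount n)) a (suc a) ≡ 0
  chords = graphArcs-miss (n ∸_) (chordCount n) a (suc a) (λ 1≤a a≤k e → chord-lands-far n 1≤a a≤k e ℕP.≤-refl)

DC-closingArc : ∀ n → 1 ≤ n → countArcs (DC n) n 1 ≡ 1
DC-closingArc n 1≤n = trans (DC-count n n 1) (cong₂ _+_ path (cong₂ _+_ closing chords))
  where
  path : countArcs (graphArcs suc (n ∸ 1)) n 1 ≡ 0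
  path = graphArcs-miss suc (n ∸ 1) n 1 (λ { _ _ refl → ℕP.<-irrefl refl 1≤n })
  closing : countArcs ((n , 1) ∷ []) n 1 ≡ 1
  closing = countArcs-hit n 1 []
  chords : countArcs (graphArcs (n ∸_) (chordCount n)) n 1 ≡ 0
  chords = graphArcs-miss (n ∸_) (chordCount n) n 1 (λ 1≤n n≤k e → chord-lands-far n 1≤n n≤k e (s≤s z≤n))

DC-chordArc : ∀ n a → 1 ≤ a → a ≤ chordCount n → countArcs (DC n) a (n ∸ a) ≡ 1
DC-chordArc n a 1≤a a≤k = trans (DC-count n a (n ∸ a)) (cong₂ _+_ path (cong₂ _+_ closing chords))
  where
  path : countArcs (graphArcs suc (n ∸ 1)) a (n ∸ a) ≡ 0
  path = graphArcs-miss suc (n ∸ 1) a (n ∸ a) (λ _ _ e → chord-lands-far n 1≤a a≤k (sym e) ℕP.≤-refl)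
  closing : countArcs ((n , 1) ∷ []) a (n ∸ a) ≡ 0
  closing = countArcs-miss n 1 [] a (n ∸ a) (λ _ e → chord-lands-far n 1≤a a≤k (sym e) (s≤s z≤n))
  chords : countArcs (graphArcs (n ∸_) (chordCount n)) a (n ∸ a) ≡ 1
  chords = graphArcs-hit (n ∸_) (chordCount n) a 1≤a a≤k

DC-loopless : ∀ n a → 2 ≤ n → countArcs (DC n) a a ≡ 0
DC-loopless n a 2≤n = DC-noArc n a a (ℕP.<⇒≢ (ℕP.n<1+n a)) (λ { refl refl → ℕP.<-irrefl refl 2≤n })
  (λ 1≤a a≤k e → chord-lands-far n 1≤a a≤k e (ℕP.n≤1+n a))

charMatrix : ∀ n → (Fin n → Fin n → ℕ) → Mat n
charMatrix n A i j = (if does (i Fin.≟ j) then X else []) -P constP (+ A i j)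

charMatrix-diagonal : ∀ {n} (A : Fin n → Fin n → ℕ) i → A i i ≡ 0 → charMatrix n A i i ≋ X
charMatrix-diagonal A i no-loop rewrite dec-true (i Fin.≟ i) refl | no-loop = ≋-refl

charMatrix-noArc : ∀ {n} (A : Fin n → Fin n → ℕ) i j → i ≢ j → A i j ≡ 0 → charMatrix n A i j ≋ []
charMatrix-noArc A i j i≢j no-arc rewrite dec-false (i Fin.≟ j) i≢j | no-arc =
  coeffwise λ { zero → refl ; (suc _) → refl }

charMatrix-arc : ∀ {n} (A : Fin n → Fin n → ℕ) i j → i ≢ j → A i j ≡ 1 → charMatrix n A i j ≋ constP -1ℤ
charMatrix-arc A i j i≢j one-arc rewrite dec-false (i Fin.≟ j) i≢j | one-arc = ≋-refl

chord-column : ∀ m r c → r + c ≡ m → suc (suc (suc m)) ∸ suc r ≡ suc (suc c)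
chord-column m r c refl = trans (cong (_∸ r) (sym (two-more r c))) (ℕP.m+n∸m≡n r (suc (suc c)))
  where
  two-more : ∀ r c → r + suc (suc c) ≡ suc (suc (r + c))
  two-more = ℕSolver.solve-∀

chord-column⁻¹ : ∀ m r c → suc (suc (suc m)) ∸ suc r ≡ suc (suc c) → r + c ≡ m
chord-column⁻¹ m r c e = ℕP.suc-injective (ℕP.suc-injective (begin
  suc (suc (r + c))          ≡⟨ two-more r c ⟨
  r + suc (suc c)            ≡⟨ cong (λ k → r + k) e ⟨
  r + (suc (suc m) ∸ r)      ≡⟨ ℕP.m+[n∸m]≡n (ℕP.<⇒≤ (ℕP.m∸n≢0⇒n<m {suc (suc m)} {r} (λ e′ → 0≢2+c (trans (sym e′) e)))) ⟩
  suc (suc m)                ∎))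
  where
  open ≡-Reasoning
  two-more : ∀ r c → r + suc (suc c) ≡ suc (suc (r + c))
  two-more = ℕSolver.solve-∀
  0≢2+c : 0 ≢ suc (suc c)
  0≢2+c ()

module DC-CharMatrix (m : ℕ) where

  n : ℕ
  n = suc (suc (suc m))

  M : Mat n
  M = charMatrix n (adjacency n (DC n))

  diagonal-X : ∀ i → M i i ≋ X
  diagonal-X i = charMatrix-diagonal (adjacency n (DC n)) i (DC-loopless n (suc (toℕ i)) (s≤s (s≤s z≤n)))

  column₀-interior : ∀ (r : Fin (suc m)) → M (Fin.suc (inject₁ r)) Fin.zero ≋ []
  column₀-interior r = charMatrix-noArc (adjacency n (DC n)) (Fin.suc (inject₁ r)) Fin.zero (λ ()) (DC-noArc n _ 1 (λ ())
    (λ e _ → ℕP.<-irrefl (ℕP.suc-injective (ℕP.suc-injective e)) (subst (_< suc m) (sym (FinP.toℕ-inject₁ r)) (FinP.toℕ<n r)))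
    (λ 1≤a a≤k e → chord-lands-far n 1≤a a≤k e (s≤s z≤n)))

  column₀-corner : M (fromℕ (suc (suc m))) Fin.zero ≋ constP -1ℤ
  column₀-corner = charMatrix-arc (adjacency n (DC n)) (fromℕ (suc (suc m))) Fin.zero (λ ())
    (subst (λ a → countArcs (DC n) a 1 ≡ 1) (sym (cong suc (FinP.toℕ-fromℕ (suc (suc m))))) (DC-closingArc n (s≤s z≤n)))

  minor₀-upperTriangular : ∀ r c → toℕ c < toℕ r → minor Fin.zero M r c ≋ []
  minor₀-upperTriangular r c c<r = charMatrix-noArc (adjacency n (DC n)) (Fin.suc r) (Fin.suc c)
    (λ e → ℕP.<⇒≢ c<r (sym (cong toℕ (FinP.suc-injective e))))
    (DC-noArc n _ _ (λ e → ℕP.<⇒≢ (ℕP.m<n⇒m<1+n c<r) (ℕP.suc-injective (ℕP.suc-injective e))) (λ _ ())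
      (λ 1≤a a≤k e → chord-lands-far n 1≤a a≤k e (s≤s (s≤s (ℕP.m≤n⇒m≤1+n (ℕP.<⇒≤ c<r))))))

  cornerMinor-chordMatrix : ChordMatrix (suc (suc m)) m (chordCount n) (cornerMinor M)
  cornerMinor-chordMatrix = record
    { room        = room
    ; inRange     = λ _ → ℕP.n≤1+n (suc m)
    ; diagonal    = path-entry
    ; subdiagonal = λ r c e → subst (λ j → M (inject₁ r) j ≋ X) (FinP.toℕ-injective (trans (row r) e)) (diagonal-X (inject₁ r))
    ; chord       = chord-entry
    ; elsewhere   = other-entry
    }
    where
    row : ∀ r → toℕ (inject₁ r) ≡ toℕ r
    row = FinP.toℕ-inject₁
    room : 2 * chordCount n ≤ suc m
    room = begin
      2 * (n / 2 ∸ 1)  ≡⟨ ℕP.*-distribˡ-∸ 2 (n / 2) 1 ⟩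
      2 * (n / 2) ∸ 2  ≤⟨ ℕP.∸-monoˡ-≤ 2 (subst (_≤ n) (ℕP.*-comm (n / 2) 2) (m/n*n≤m n 2)) ⟩
      suc m            ∎
      where open ℕP.≤-Reasoning
    path-entry : ∀ r c → toℕ r ≡ toℕ c → M (inject₁ r) (Fin.suc c) ≋ constP -1ℤ
    path-entry r c e = charMatrix-arc (adjacency n (DC n)) (inject₁ r) (Fin.suc c)
      (λ e′ → ℕP.<⇒≢ (ℕP.n<1+n (toℕ c)) (trans (sym (trans (row r) e)) (cong toℕ e′)))
      (subst (λ a → countArcs (DC n) (suc a) (suc (suc (toℕ c))) ≡ 1) (sym (trans (row r) e))
        (DC-pathArc n (suc (toℕ c)) (s≤s z≤n) (FinP.toℕ<n c)))
    chord-entry : ∀ r c → toℕ r < chordCount n → toℕ r + toℕ c ≡ m → M (inject₁ r) (Fin.suc c) ≋ constP -1ℤ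
    chord-entry r c r<k e = charMatrix-arc (adjacency n (DC n)) (inject₁ r) (Fin.suc c) not-diagonal
      (subst (λ b → countArcs (DC n) (suc r′) b ≡ 1) lands (DC-chordArc n (suc r′) (s≤s z≤n) a≤k))
      where
      r′ : ℕ
      r′ = toℕ (inject₁ r)
      a≤k : suc r′ ≤ chordCount n
      a≤k = subst (λ x → suc x ≤ chordCount n) (sym (row r)) r<k
      lands : n ∸ suc r′ ≡ suc (suc (toℕ c))
      lands = chord-column m r′ (toℕ c) (trans (cong (λ x → x + toℕ c) (row r)) e)
      not-diagonal : inject₁ r ≢ Fin.suc c
      not-diagonal e′ = chord-lands-far n (s≤s z≤n) a≤k lands
        (s≤s (s≤s (subst (toℕ c ≤_) (sym (cong toℕ e′)) (ℕP.n≤1+n (toℕ c)))))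
    other-entry : ∀ r c → toℕ r ≢ toℕ c → toℕ r ≢ suc (toℕ c) → (toℕ r < chordCount n → toℕ r + toℕ c ≢ m) →
      M (inject₁ r) (Fin.suc c) ≋ []
    other-entry r c r≢c r≢1+c not-chord = charMatrix-noArc (adjacency n (DC n)) (inject₁ r) (Fin.suc c)
      (λ e′ → r≢1+c (trans (sym (row r)) (cong toℕ e′)))
      (DC-noArc n (suc r′) (suc (suc (toℕ c)))
        (λ e′ → r≢c (trans (sym (row r)) (sym (ℕP.suc-injective (ℕP.suc-injective e′)))))
        (λ e′ _ → ℕP.<-irrefl (ℕP.suc-injective e′) (subst (_< suc (suc m)) (sym (row r)) (FinP.toℕ<n r)))
        (λ _ a≤k e′ → not-chord (subst (λ x → suc x ≤ chordCount n) (row r) a≤k)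
                                (chord-column⁻¹ m (toℕ r) (toℕ c) (subst (λ x → n ∸ suc x ≡ suc (suc (toℕ c))) (row r) e′))))
      where
      r′ : ℕ
      r′ = toℕ (inject₁ r)

-- The sum Σ_{t=1}^{K} x^(E - (2t+1)) of the statement is descendingPowers (E - 3) K.

sumP-applyUpTo : ∀ K (f : ℕ → Poly) J → (∀ t → f t ≡ X^ (J ∸ 2 * t)) → sumP (applyUpTo f K) ≋ descendingPowers J K
sumP-applyUpTo zero    f J exponents = ≋-refl
sumP-applyUpTo (suc K) f J exponents =
  +P-cong (≋-reflexive (exponents 0)) (sumP-applyUpTo K (f ∘ suc) (J ∸ 2) later-exponents)
  where
  later-exponents : ∀ t → f (suc t) ≡ X^ (J ∸ 2 ∸ 2 * t)
  later-exponents t = trans (exponents (suc t))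
    (cong X^ (trans (cong (J ∸_) (ℕP.*-suc 2 t)) (sym (ℕP.∸-+-assoc J 2 (2 * t)))))

sumP-oddGaps : ∀ E K → sumP (map (λ t → X^ (E ∸ (2 * t + 1))) (oneTo K)) ≋ descendingPowers (E ∸ 3) K
sumP-oddGaps E K = ≋-trans (≋-reflexive (cong sumP as-applyUpTo)) (sumP-applyUpTo K (F ∘ suc) (E ∸ 3) exponents)
  where
  F : ℕ → Poly
  F t = X^ (E ∸ (2 * t + 1))
  as-applyUpTo : map F (oneTo K) ≡ applyUpTo (F ∘ suc) K
  as-applyUpTo = trans (cong (map F) (LP.map-upTo suc K)) (LP.map-applyUpTo suc F K)
  regroup : ∀ t → 2 * suc t + 1 ≡ 3 + 2 * t
  regroup = ℕSolver.solve-∀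
  exponents : ∀ t → F (suc t) ≡ X^ (E ∸ 3 ∸ 2 * t)
  exponents t = cong X^ (trans (cong (E ∸_) (regroup t)) (sym (ℕP.∸-+-assoc E 3 (2 * t))))

cornerStep-algebra : ∀ s → s ℤ.* s ≡ + 1 → ∀ P D E → P +P s ·P (-1ℤ ·P (s ·P (D +P E))) ≋ (P -P D) -P E
cornerStep-algebra s s²≡1 P D E = coeffwise λ i → begin
  coeff (P +P s ·P (-1ℤ ·P (s ·P (D +P E)))) i
    ≡⟨ coeff-+P P (s ·P (-1ℤ ·P (s ·P (D +P E)))) i ⟩
  coeff P i ℤ.+ coeff (s ·P (-1ℤ ·P (s ·P (D +P E)))) i
    ≡⟨ cong (λ v → coeff P i ℤ.+ v) (coeff-scalars i) ⟩
  coeff P i ℤ.+ s ℤ.* (-1ℤ ℤ.* (s ℤ.* (coeff D i ℤ.+ coeff E i)))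
    ≡⟨ square-out s (coeff P i) (coeff D i) (coeff E i) ⟩
  coeff P i ℤ.+ -1ℤ ℤ.* ((s ℤ.* s) ℤ.* (coeff D i ℤ.+ coeff E i))
    ≡⟨ cong (λ v → coeff P i ℤ.+ -1ℤ ℤ.* (v ℤ.* (coeff D i ℤ.+ coeff E i))) s²≡1 ⟩
  coeff P i ℤ.+ -1ℤ ℤ.* (+ 1 ℤ.* (coeff D i ℤ.+ coeff E i))
    ≡⟨ distribute (coeff P i) (coeff D i) (coeff E i) ⟩
  (coeff P i ℤ.+ - coeff D i) ℤ.+ - coeff E i
    ≡⟨ cong₂ (λ u v → (coeff P i ℤ.+ u) ℤ.+ v) (coeff-negP D i) (coeff-negP E i) ⟨
  (coeff P i ℤ.+ coeff (negP D) i) ℤ.+ coeff (negP E) i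
    ≡⟨ cong (ℤ._+ coeff (negP E) i) (coeff-+P P (negP D) i) ⟨
  coeff (P -P D) i ℤ.+ coeff (negP E) i
    ≡⟨ coeff-+P (P -P D) (negP E) i ⟨
  coeff ((P -P D) -P E) i
    ∎
  where
  open ≡-Reasoning
  coeff-scalars : ∀ i → coeff (s ·P (-1ℤ ·P (s ·P (D +P E)))) i ≡ s ℤ.* (-1ℤ ℤ.* (s ℤ.* (coeff D i ℤ.+ coeff E i)))
  coeff-scalars i =
    trans (coeff-·P s (-1ℤ ·P (s ·P (D +P E))) i)
      (cong (s ℤ.*_) (trans (coeff-·P -1ℤ (s ·P (D +P E)) i)
        (cong (-1ℤ ℤ.*_) (trans (coeff-·P s (D +P E) i) (cong (s ℤ.*_) (coeff-+P D E i))))))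
  square-out : ∀ s p d e → p ℤ.+ s ℤ.* (-1ℤ ℤ.* (s ℤ.* (d ℤ.+ e))) ≡ p ℤ.+ -1ℤ ℤ.* ((s ℤ.* s) ℤ.* (d ℤ.+ e))
  square-out = solve-∀
  distribute : ∀ p d e → p ℤ.+ -1ℤ ℤ.* (+ 1 ℤ.* (d ℤ.+ e)) ≡ (p ℤ.+ - d) ℤ.+ - e
  distribute = solve-∀

mainTheorem1 : (n : ℕ) → 3 ≤ n →
    charPoly n (adjacency n (DC n))
    ≈P (X^ n -P sumP (map (λ t → X^ (n ∸ (2 * t + 1))) (oneTo ((n / 2) ∸ 1)))) -P constP (+ 1)
mainTheorem1 zero             ()
mainTheorem1 (suc zero)       (s≤s ())
mainTheorem1 (suc (suc zero)) (s≤s (s≤s ()))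
mainTheorem1 (suc (suc (suc m))) _ = coeff-≡ (begin
  det n M
    ≈⟨ det-column-corner (suc m) M -1ℤ column₀-interior column₀-corner ⟩
  M Fin.zero Fin.zero *P det (suc (suc m)) (minor Fin.zero M) +P s ·P (-1ℤ ·P det (suc (suc m)) (cornerMinor M))
    ≈⟨ +P-cong (*P-cong (diagonal-X Fin.zero) diagonal-block) (·P-cong s (·P-cong -1ℤ chord-block)) ⟩
  X *P X^ (suc (suc m)) +P s ·P (-1ℤ ·P (s ·P (descendingPowers m (chordCount n) +P constP (+ 1))))
    ≈⟨ +P-cong (X-*P (X^ (suc (suc m)))) (≋-refl {s ·P (-1ℤ ·P (s ·P (descendingPowers m (chordCount n) +P constP (+ 1))))}) ⟩
  X^ n +P s ·P (-1ℤ ·P (s ·P (descendingPowers m (chordCount n) +P constP (+ 1))))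
    ≈⟨ cornerStep-algebra s (sign-square (suc (suc m))) (X^ n) (descendingPowers m (chordCount n)) (constP (+ 1)) ⟩
  (X^ n -P descendingPowers m (chordCount n)) -P constP (+ 1)
    ≈⟨ -P-cong (-P-cong (≋-refl {X^ n}) (≋-sym (sumP-oddGaps n (chordCount n)))) (≋-refl {constP (+ 1)}) ⟩
  (X^ n -P sumP (map (λ t → X^ (n ∸ (2 * t + 1))) (oneTo (chordCount n)))) -P constP (+ 1)
    ∎)
  where
  open DC-CharMatrix m
  open ≋-Reasoning
  s : ℤ
  s = sign (suc (suc m))
  diagonal-block : det (suc (suc m)) (minor Fin.zero M) ≋ X^ (suc (suc m))
  diagonal-block = det-upperTriangular-X (suc (suc m)) (minor Fin.zero M) minor₀-upperTriangular (λ i → diagonal-X (Fin.suc i))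
  chord-block : det (suc (suc m)) (cornerMinor M) ≋ s ·P (descendingPowers m (chordCount n) +P constP (+ 1))
  chord-block = det-chordMatrix (suc (suc m)) m (chordCount n) (cornerMinor M) cornerMinor-chordMatrix
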